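{- Let $t\ge 2$ and let $G$ be a graph with $\chi_{la}(G)=t$. Suppose $f$ is a local antimagic labeling of $G$ whose induced color classes form a partition $V(G)=V_1\cup\cdots\cup V_t$ into $t$ independent sets (so $f^+$ is constant on each $V_k$ and takes different values on different $V_k$). Suppose further that for each $k$ all vertices of $V_k$ have the same degree $d_k$, and that $f^+(x)-d_a\ne f^+(y)-d_b$ whenever $x\in V_a$, $y\in V_b$ with $1\le a\ne b\le t$. If $e$ is an edge of $G$ with $f(e)=1$ and $H=G-e$, then $\chi(H)\le\chi_{la}(H)\le t$.
   Context: For a graph $G=(V,E)$, a local antimagic labeling is a bijection $f:E\to\{1,\dots,|E|\}$ such that, with $f^+(u)=\sum_{e\ni u} f(e)$, adjacent vertices receive distinct values of $f^+$; $c(f)$ is the number of distinct values of $f^+$ and $\chi_{la}(G)$ is the minimum of $c(f)$ over all local antimagic labelings. $\chi$ denotes the ordinary chromatic number and $G-e$ is $G$ with edge $e$ deleted. -}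

module Defs where

open import Data.Nat using (ℕ; zero; suc; _≤_)
open import Data.Nat.Properties using (_≟_)
open import Data.Fin using (Fin; toℕ; punchIn)
open import Data.Fin.Properties renaming (_≟_ to _≟F_)
open import Data.Bool using (Bool; if_then_else_; _∨_)
open import Data.List using (List; map; length; deduplicate; allFin)
open import Data.Nat.ListAction using (sum)
open import Data.Product using (Σ; _×_; proj₁; proj₂)
open import Data.Sum using (_⊎_)
open import Relation.Nullary using (¬_)
open import Relation.Nullary.Decidable using (⌊_⌋)
open import Relation.Binary.PropositionalEquality using (_≡_; _≢_)
open import Function.Definitions using (Bijective)

-- A graph on vertex set Fin n with m edges, given by its edge list:
-- edge i has endpoints ends i.
Graph : ℕ → ℕ → Set
Graph n m = Fin m → Fin n × Fin n

SameEdge : ∀ {n} → Fin n × Fin n → Fin n × Fin n → Set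
SameEdge p q = (proj₁ p ≡ proj₁ q × proj₂ p ≡ proj₂ q) ⊎ (proj₁ p ≡ proj₂ q × proj₂ p ≡ proj₁ q)

IsSimple : ∀ {n m} → Graph n m → Set
IsSimple {n} {m} G =
  (∀ i → proj₁ (G i) ≢ proj₂ (G i)) × (∀ i j → SameEdge (G i) (G j) → i ≡ j)

incident : ∀ {n m} → Graph n m → Fin m → Fin n → Bool
incident G i u = ⌊ u ≟F proj₁ (G i) ⌋ ∨ ⌊ u ≟F proj₂ (G i) ⌋

-- A labeling is f : Fin m → Fin m; edge i gets label f i + 1 ∈ {1,…,m}.
label : ∀ {m} → (Fin m → Fin m) → Fin m → ℕ
label f i = suc (toℕ (f i))

vsum : ∀ {n m} → Graph n m → (Fin m → Fin m) → Fin n → ℕ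
vsum {n} {m} G f u = sum (map (λ i → if incident G i u then label f i else 0) (allFin m))

deg : ∀ {n m} → Graph n m → Fin n → ℕ
deg {n} {m} G u = sum (map (λ i → if incident G i u then 1 else 0) (allFin m))

IsLocalAntimagic : ∀ {n m} → Graph n m → (Fin m → Fin m) → Set
IsLocalAntimagic G f =
  Bijective _≡_ _≡_ f × (∀ i → vsum G f (proj₁ (G i)) ≢ vsum G f (proj₂ (G i)))

numColors : ∀ {n m} → Graph n m → (Fin m → Fin m) → ℕ
numColors {n} G f = length (deduplicate _≟_ (map (vsum G f) (allFin n)))

LAAttains : ∀ {n m} → Graph n m → ℕ → Set
LAAttains {n} {m} G s = Σ (Fin m → Fin m) λ f → IsLocalAntimagic G f × numColors G f ≡ s

IsLAChromaticNumber : ∀ {n m} → Graph n m → ℕ → Set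
IsLAChromaticNumber G t = LAAttains G t × (∀ s → LAAttains G s → t ≤ s)

ProperColorable : ∀ {n m} → Graph n m → ℕ → Set
ProperColorable {n} G k = Σ (Fin n → Fin k) λ c → ∀ i → c (proj₁ (G i)) ≢ c (proj₂ (G i))

IsChromaticNumber : ∀ {n m} → Graph n m → ℕ → Set
IsChromaticNumber G k = ProperColorable G k × (∀ j → ProperColorable G j → k ≤ j)

deleteEdge : ∀ {n m} → Graph n (suc m) → Fin (suc m) → Graph n m
deleteEdge G e i = G (punchIn e i)

-- Relabel H by `lower`: the label of every other edge decreases by 1,
-- a bijection onto {1,…,m}.  Each edge at x loses one unit (e loses its whole label),
-- so f⁺(x) = deg_G(x) + lower⁺(x).  The hypotheses (equal f⁺ forces equal degree;
-- distinct f⁺ stay distinct after subtracting degrees) say that lower⁺ and f⁺ have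
-- the same kernel.  So lower is local antimagic on H with c(lower) = c(f) = t, giving
-- χ_la(H) ≤ t; and any local antimagic h is a proper c(h)-colouring, so χ(H) ≤ χ_la(H).
-- Constructively both invariants must be exhibited: attaining a value is decidable by
-- exhaustive search, and a decidable inhabited predicate on ℕ has a least element.
module Submission where

open import Defs
open import Data.Nat using (ℕ; zero; suc; _≤_; _<_; _∸_; _+_)
open import Data.Nat.Properties
  using (_≟_; _≤?_; m+n∸m≡n; ≰⇒>; n<1+n; m<n⇒m<1+n; m<1+n⇒m<n∨m≡n; m<1+n⇒m≤n
        ; +-0-commutativeMonoid)
open import Data.Fin using (Fin; toℕ; punchIn; punchOut) renaming (zero to 0F; suc to sucF)
open import Data.Fin.Properties
  using (toℕ-injective; punchInᵢ≢i; punchOut-injective; punchIn-punchOut; punchIn-injective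
        ; suc-injective; any?; all?)
  renaming (_≟_ to _≟F_)
open import Data.Bool using (true; false; if_then_else_)
open import Data.List using (List; []; _∷_; map; length; deduplicate; allFin; tabulate; filter; lookup)
open import Data.List.Properties using (map-tabulate; length-map; filter-≐)
open import Data.List.Membership.Propositional using (_∈_)
open import Data.List.Membership.Propositional.Properties using (∈-map⁺; ∈-allFin; ∈-deduplicate⁺)
open import Data.List.Relation.Unary.Any using (index)
open import Data.List.Relation.Unary.Any.Properties using (lookup-index)
open import Data.Nat.ListAction using (sum)
open import Algebra.Properties.CommutativeMonoid.Sum +-0-commutativeMonoid
  using (sum-remove; ∑-distrib-+; sum-cong-≗) renaming (sum to ∑)
open import Data.Product using (Σ; _×_; _,_; proj₁; proj₂)
open import Data.Sum using (_⊎_; inj₁; inj₂)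
open import Relation.Nullary using (¬_; Dec; yes; no; ¬?; contradiction)
open import Relation.Nullary.Decidable using (_×-dec_; _→-dec_; map′)
open import Relation.Binary.PropositionalEquality
  using (_≡_; _≢_; refl; sym; trans; cong; cong₂; subst; module ≡-Reasoning)
open import Function.Definitions using (Bijective)
open import Data.Vec.Functional using () renaming (_∷_ to _◂_)
open import Function using (id; _∘_)

open ≡-Reasoning

-- The list sums used in Defs agree with the finite sums ∑ of the algebra library,
-- which come with the lemmas we need (pulling out one term, additivity).
listSum-tabulate : ∀ {k} (h : Fin k → ℕ) → sum (tabulate h) ≡ ∑ h
listSum-tabulate {zero} h = refl
listSum-tabulate {suc k} h = cong (h 0F +_) (listSum-tabulate (h ∘ sucF))

listSum-allFin : ∀ {k} (h : Fin k → ℕ) → sum (map h (allFin k)) ≡ ∑ h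
listSum-allFin h = trans (cong sum (map-tabulate id h)) (listSum-tabulate h)

-- Both f⁺ (weights = labels) and the degree (weights = 1) are weighted degrees.
-- (`atVertex G w x i` is the weight of edge i if it is incident with x, else 0.)
atVertex : ∀ {n m} → Graph n m → (Fin m → ℕ) → Fin n → Fin m → ℕ
atVertex G w x i = if incident G i x then w i else 0

wdeg : ∀ {n m} → Graph n m → (Fin m → ℕ) → Fin n → ℕ
wdeg G w x = ∑ (atVertex G w x)

vsum≡wdeg : ∀ {n m} (G : Graph n m) f x → vsum G f x ≡ wdeg G (label f) x
vsum≡wdeg G f x = listSum-allFin (atVertex G (label f) x)

deg≡wdeg : ∀ {n m} (G : Graph n m) x → deg G x ≡ wdeg G (λ _ → 1) x
deg≡wdeg G x = listSum-allFin (atVertex G (λ _ → 1) x)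

wdeg-cong : ∀ {n m} (G : Graph n m) {v w : Fin m → ℕ} → (∀ i → v i ≡ w i) → ∀ x →
  wdeg G v x ≡ wdeg G w x
wdeg-cong G {v} {w} v≗w x = sum-cong-≗ {x = atVertex G v x} {atVertex G w x}
  (λ i → cong (if incident G i x then_else 0) (v≗w i))

wdeg-+ : ∀ {n m} (G : Graph n m) (v w : Fin m → ℕ) x →
  wdeg G (λ i → v i + w i) x ≡ wdeg G v x + wdeg G w x
wdeg-+ G v w x = trans
  (sum-cong-≗ {x = atVertex G (λ i → v i + w i) x} (λ i → if-+ (incident G i x)))
  (∑-distrib-+ (atVertex G v x) (atVertex G w x))
  where
  if-+ : ∀ b {p q} → (if b then p + q else 0) ≡ (if b then p else 0) + (if b then q else 0)
  if-+ true = refl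
  if-+ false = refl

wdeg-deleteEdge : ∀ {n m} (G : Graph n (suc m)) e (w : Fin (suc m) → ℕ) x →
  wdeg G w x ≡ (if incident G e x then w e else 0) + wdeg (deleteEdge G e) (w ∘ punchIn e) x
wdeg-deleteEdge G e w x = sum-remove {i = e} (atVertex G w x)

module LowerLabels {m} (f : Fin (suc m) → Fin (suc m)) (f-bij : Bijective _≡_ _≡_ f)
  (e : Fin (suc m)) (f[e]≡0 : f e ≡ 0F) where

  avoids-0 : ∀ i → 0F ≢ f (punchIn e i)
  avoids-0 i 0≡f = punchInᵢ≢i e i (sym (proj₁ f-bij (trans f[e]≡0 0≡f)))

  lower : Fin m → Fin m
  lower i = punchOut (avoids-0 i)

  suc-lower : ∀ i → sucF (lower i) ≡ f (punchIn e i)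
  suc-lower i = punchIn-punchOut (avoids-0 i)

  lower-bij : Bijective _≡_ _≡_ lower
  lower-bij = injective , surjective
    where
    injective : ∀ {i j} → lower i ≡ lower j → i ≡ j
    injective {i} {j} eq =
      punchIn-injective e i j (proj₁ f-bij (punchOut-injective (avoids-0 i) (avoids-0 j) eq))

    surjective : ∀ y → Σ (Fin m) λ i → ∀ {z} → z ≡ i → lower z ≡ y
    surjective y = punchOut e≢x , λ { refl → lower-hits }
      where
      x : Fin (suc m)
      x = proj₁ (proj₂ f-bij (sucF y))
      f[x]≡1+y : f x ≡ sucF y
      f[x]≡1+y = proj₂ (proj₂ f-bij (sucF y)) refl
      e≢x : e ≢ x
      e≢x refl with trans (sym f[e]≡0) f[x]≡1+y
      ... | ()
      lower-hits : lower (punchOut e≢x) ≡ y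
      lower-hits = suc-injective (begin
        sucF (lower (punchOut e≢x))  ≡⟨ suc-lower (punchOut e≢x) ⟩
        f (punchIn e (punchOut e≢x)) ≡⟨ cong f (punchIn-punchOut e≢x) ⟩
        f x                          ≡⟨ f[x]≡1+y ⟩
        sucF y                       ∎)

  -- Measured with the weights f - 1, the edge e weighs nothing and every other edge
  -- weighs its `lower` label, so this weighted degree is lower⁺ computed in G - e.
  wdeg-shifted : ∀ {n} (G : Graph n (suc m)) x →
    wdeg G (toℕ ∘ f) x ≡ vsum (deleteEdge G e) lower x
  wdeg-shifted {n} G x = begin
    wdeg G (toℕ ∘ f) x
      ≡⟨ wdeg-deleteEdge G e (toℕ ∘ f) x ⟩
    (if incident G e x then toℕ (f e) else 0) + wdeg H (toℕ ∘ f ∘ punchIn e) x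
      ≡⟨ cong (_+ wdeg H (toℕ ∘ f ∘ punchIn e) x) (e-weighs-0 (incident G e x)) ⟩
    wdeg H (toℕ ∘ f ∘ punchIn e) x
      ≡⟨ wdeg-cong H (λ i → cong toℕ (sym (suc-lower i))) x ⟩
    wdeg H (label lower) x
      ≡⟨ vsum≡wdeg H lower x ⟨
    vsum H lower x
      ∎
    where
    H : Graph n m
    H = deleteEdge G e
    e-weighs-0 : ∀ b → (if b then toℕ (f e) else 0) ≡ 0
    e-weighs-0 true = cong toℕ f[e]≡0
    e-weighs-0 false = refl

  -- Every label is 1 + (f - 1), so f⁺(x) = deg_G(x) + lower⁺(x).
  vsum-lower : ∀ {n} (G : Graph n (suc m)) x →
    vsum G f x ≡ deg G x + vsum (deleteEdge G e) lower x
  vsum-lower G x = begin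
    vsum G f x                                ≡⟨ vsum≡wdeg G f x ⟩
    wdeg G (λ j → 1 + toℕ (f j)) x            ≡⟨ wdeg-+ G (λ _ → 1) (toℕ ∘ f) x ⟩
    wdeg G (λ _ → 1) x + wdeg G (toℕ ∘ f) x   ≡⟨ cong₂ _+_ (sym (deg≡wdeg G x)) (wdeg-shifted G x) ⟩
    deg G x + vsum (deleteEdge G e) lower x   ∎

module DistinctValues {A : Set} where

  dedupBy : (A → ℕ) → List A → List A
  dedupBy h = deduplicate (λ a b → h a ≟ h b)

  filter-map : ∀ {P : ℕ → Set} (P? : ∀ v → Dec (P v)) (h : A → ℕ) (xs : List A) →
    filter P? (map h xs) ≡ map h (filter (P? ∘ h) xs)
  filter-map P? h [] = refl
  filter-map P? h (x ∷ xs) with P? (h x)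
  ... | yes _ = cong (h x ∷_) (filter-map P? h xs)
  ... | no _ = filter-map P? h xs

  deduplicate-map : (h : A → ℕ) (xs : List A) → deduplicate _≟_ (map h xs) ≡ map h (dedupBy h xs)
  deduplicate-map h [] = refl
  deduplicate-map h (x ∷ xs) = cong (h x ∷_) (begin
    filter (¬? ∘ (h x ≟_)) (deduplicate _≟_ (map h xs))  ≡⟨ cong (filter (¬? ∘ (h x ≟_))) (deduplicate-map h xs) ⟩
    filter (¬? ∘ (h x ≟_)) (map h (dedupBy h xs))        ≡⟨ filter-map (¬? ∘ (h x ≟_)) h (dedupBy h xs) ⟩
    map h (filter (¬? ∘ (h x ≟_) ∘ h) (dedupBy h xs))    ∎)

  dedupBy-kernel : (h k : A → ℕ) → (∀ a b → h a ≡ h b → k a ≡ k b) →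
    (∀ a b → k a ≡ k b → h a ≡ h b) → ∀ xs → dedupBy h xs ≡ dedupBy k xs
  dedupBy-kernel h k h⇒k k⇒h [] = refl
  dedupBy-kernel h k h⇒k k⇒h (x ∷ xs) = cong (x ∷_) (begin
    filter (λ y → ¬? (h x ≟ h y)) (dedupBy h xs)  ≡⟨ cong (filter _) (dedupBy-kernel h k h⇒k k⇒h xs) ⟩
    filter (λ y → ¬? (h x ≟ h y)) (dedupBy k xs)  ≡⟨ filter-≐ _ _ same-test (dedupBy k xs) ⟩
    filter (λ y → ¬? (k x ≟ k y)) (dedupBy k xs)  ∎)
    where
    same-test : (∀ {y} → h x ≢ h y → k x ≢ k y) × (∀ {y} → k x ≢ k y → h x ≢ h y)
    same-test = (λ {y} h-differs k-eq → h-differs (k⇒h x y k-eq))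
              , (λ {y} k-differs h-eq → k-differs (h⇒k x y h-eq))

  countDistinct-kernel : (h k : A → ℕ) → (∀ a b → h a ≡ h b → k a ≡ k b) →
    (∀ a b → k a ≡ k b → h a ≡ h b) → ∀ xs →
    length (deduplicate _≟_ (map h xs)) ≡ length (deduplicate _≟_ (map k xs))
  countDistinct-kernel h k h⇒k k⇒h xs = begin
    length (deduplicate _≟_ (map h xs))  ≡⟨ cong length (deduplicate-map h xs) ⟩
    length (map h (dedupBy h xs))        ≡⟨ length-map h (dedupBy h xs) ⟩
    length (dedupBy h xs)                ≡⟨ cong length (dedupBy-kernel h k h⇒k k⇒h xs) ⟩
    length (dedupBy k xs)                ≡⟨ length-map k (dedupBy k xs) ⟨
    length (map k (dedupBy k xs))        ≡⟨ cong length (deduplicate-map k xs) ⟨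
    length (deduplicate _≟_ (map k xs))  ∎

open DistinctValues using (countDistinct-kernel)

-- A local antimagic labeling h yields a proper colouring with c(h) colours: colour
-- x by the position of h⁺(x) in the list of distinct values of h⁺.
colouring-from-labeling : ∀ {n m} (G : Graph n m) (h : Fin m → Fin m) →
  IsLocalAntimagic G h → ProperColorable G (numColors G h)
colouring-from-labeling {n} G h (_ , adjacent-distinct) = colour , proper
  where
  values : List ℕ
  values = deduplicate _≟_ (map (vsum G h) (allFin n))

  listed : ∀ x → vsum G h x ∈ values
  listed x = ∈-deduplicate⁺ _≟_ (∈-map⁺ (vsum G h) (∈-allFin x))

  colour : Fin n → Fin (numColors G h)
  colour x = index (listed x)

  proper : ∀ i → colour (proj₁ (G i)) ≢ colour (proj₂ (G i))
  proper i same = adjacent-distinct i (begin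
    vsum G h (proj₁ (G i))                  ≡⟨ lookup-index (listed (proj₁ (G i))) ⟩
    lookup values (colour (proj₁ (G i)))    ≡⟨ cong (lookup values) same ⟩
    lookup values (colour (proj₂ (G i)))    ≡⟨ lookup-index (listed (proj₂ (G i))) ⟨
    vsum G h (proj₂ (G i))                  ∎)

attains⇒colourable : ∀ {n m} (G : Graph n m) {s} → LAAttains G s → ProperColorable G s
attains⇒colourable G (h , h-la , c[h]≡s) =
  subst (ProperColorable G) c[h]≡s (colouring-from-labeling G h h-la)

Extensional : ∀ {n k} → ((Fin n → Fin k) → Set) → Set
Extensional P = ∀ {a b} → (∀ x → a x ≡ b x) → P a → P b

search-functions : ∀ n k (P : (Fin n → Fin k) → Set) → Extensional P →
  (∀ a → Dec (P a)) → Dec (Σ (Fin n → Fin k) P)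
search-functions zero k P ext P? with P? (λ ())
... | yes p = yes ((λ ()) , p)
... | no ¬p = no λ (a , pa) → ¬p (ext (λ ()) pa)
search-functions (suc n) k P ext P? with any? (λ b → search-functions n k (P ∘ (b ◂_))
    (λ a≗a′ → ext λ { 0F → refl ; (sucF x) → a≗a′ x }) (P? ∘ (b ◂_)))
... | yes (b , a , pa) = yes ((b ◂ a) , pa)
... | no ¬∃ = no λ (a , pa) →
  ¬∃ (a 0F , a ∘ sucF , ext (λ { 0F → refl ; (sucF x) → refl }) pa)

dec-bijective : ∀ {m} (h : Fin m → Fin m) → Dec (Bijective _≡_ _≡_ h)
dec-bijective h = map′ to from
  (all? (λ x → all? (λ y → (h x ≟F h y) →-dec (x ≟F y))) ×-dec all? (λ y → any? (λ x → h x ≟F y)))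
  where
  to : (∀ x y → h x ≡ h y → x ≡ y) × (∀ y → Σ _ λ x → h x ≡ y) → Bijective _≡_ _≡_ h
  to (inj , surj) = (λ {x} {y} → inj x y) , λ y → proj₁ (surj y) , λ { refl → proj₂ (surj y) }
  from : Bijective _≡_ _≡_ h → (∀ x y → h x ≡ h y → x ≡ y) × (∀ y → Σ _ λ x → h x ≡ y)
  from (inj , surj) = (λ x y → inj) , (λ y → proj₁ (surj y) , proj₂ (surj y) refl)

vsum-ext : ∀ {n m} (G : Graph n m) {a b : Fin m → Fin m} → (∀ i → a i ≡ b i) →
  ∀ x → vsum G a x ≡ vsum G b x
vsum-ext G {a} {b} a≗b x = begin
  vsum G a x            ≡⟨ vsum≡wdeg G a x ⟩
  wdeg G (label a) x    ≡⟨ wdeg-cong G (λ i → cong (suc ∘ toℕ) (a≗b i)) x ⟩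
  wdeg G (label b) x    ≡⟨ vsum≡wdeg G b x ⟨
  vsum G b x            ∎

attains-extensional : ∀ {n m} (G : Graph n m) s →
  Extensional (λ h → IsLocalAntimagic G h × numColors G h ≡ s)
attains-extensional {n} G s {a} {b} a≗b (((inj , surj) , adjacent-distinct) , c[a]≡s) =
  ((inj′ , surj′) , adjacent-distinct′) , trans c[b]≡c[a] c[a]≡s
  where
  inj′ : ∀ {x y} → b x ≡ b y → x ≡ y
  inj′ {x} {y} eq = inj (trans (a≗b x) (trans eq (sym (a≗b y))))
  surj′ : ∀ y → Σ _ λ x → ∀ {z} → z ≡ x → b z ≡ y
  surj′ y = proj₁ (surj y) , λ {z} z≡x → trans (sym (a≗b z)) (proj₂ (surj y) z≡x)
  adjacent-distinct′ : ∀ i → vsum G b (proj₁ (G i)) ≢ vsum G b (proj₂ (G i))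
  adjacent-distinct′ i eq = adjacent-distinct i
    (trans (vsum-ext G a≗b (proj₁ (G i))) (trans eq (sym (vsum-ext G a≗b (proj₂ (G i))))))
  c[b]≡c[a] : numColors G b ≡ numColors G a
  c[b]≡c[a] = countDistinct-kernel (vsum G b) (vsum G a)
    (λ x y eq → trans (vsum-ext G a≗b x) (trans eq (sym (vsum-ext G a≗b y))))
    (λ x y eq → trans (sym (vsum-ext G a≗b x)) (trans eq (vsum-ext G a≗b y)))
    (allFin n)

dec-attains : ∀ {n m} (G : Graph n m) s → Dec (LAAttains G s)
dec-attains {m = m} G s = search-functions m m _ (attains-extensional G s) λ h →
  (dec-bijective h ×-dec all? (λ i → ¬? (vsum G h (proj₁ (G i)) ≟ vsum G h (proj₂ (G i)))))
    ×-dec (numColors G h ≟ s)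

dec-colourable : ∀ {n m} (G : Graph n m) k → Dec (ProperColorable G k)
dec-colourable {n} G k = search-functions n k _
  (λ a≗b proper i eq → proper i (trans (a≗b (proj₁ (G i))) (trans eq (sym (a≗b (proj₂ (G i)))))))
  (λ c → all? (λ i → ¬? (c (proj₁ (G i)) ≟F c (proj₂ (G i)))))

IsLeast : (ℕ → Set) → ℕ → Set
IsLeast P s = P s × (∀ s′ → P s′ → s ≤ s′)

module LeastNumber {P : ℕ → Set} (P? : ∀ s → Dec (P s)) where

  search-below : ∀ b → (∀ j → j < b → ¬ P j) ⊎ Σ ℕ λ s → s < b × P s × (∀ j → j < s → ¬ P j)
  search-below zero = inj₁ λ _ ()
  search-below (suc b) with search-below b
  ... | inj₂ (s , s<b , ps , none-below) = inj₂ (s , m<n⇒m<1+n s<b , ps , none-below)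
  ... | inj₁ none-below with P? b
  ...   | yes pb = inj₂ (b , n<1+n b , pb , none-below)
  ...   | no ¬pb = inj₁ λ j j<1+b → case-< (m<1+n⇒m<n∨m≡n j<1+b)
    where
    case-< : ∀ {j} → j < b ⊎ j ≡ b → ¬ P j
    case-< (inj₁ j<b) = none-below _ j<b
    case-< (inj₂ refl) = ¬pb

  least : ∀ {s₀} → P s₀ → Σ ℕ λ s → IsLeast P s × s ≤ s₀
  least {s₀} ps₀ with search-below (suc s₀)
  ... | inj₁ none = contradiction ps₀ (none s₀ (n<1+n s₀))
  ... | inj₂ (s , s<1+s₀ , ps , none-below) = s , (ps , minimal) , m<1+n⇒m≤n s<1+s₀
    where
    minimal : ∀ s′ → P s′ → s ≤ s′
    minimal s′ ps′ with s ≤? s′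
    ... | yes s≤s′ = s≤s′
    ... | no s≰s′ = contradiction ps′ (none-below s′ (≰⇒> s≰s′))

open LeastNumber using (least)

mainTheorem14 : (n m t : ℕ) (G : Graph n (suc m)) (f : Fin (suc m) → Fin (suc m)) (e : Fin (suc m)) →
    2 ≤ t → IsSimple G → IsLAChromaticNumber G t →
    IsLocalAntimagic G f → numColors G f ≡ t →
    (∀ x y → vsum G f x ≡ vsum G f y → deg G x ≡ deg G y) →
    (∀ x y → vsum G f x ≢ vsum G f y → vsum G f x ∸ deg G x ≢ vsum G f y ∸ deg G y) →
    toℕ (f e) ≡ 0 →
    Σ ℕ λ s → IsLAChromaticNumber (deleteEdge G e) s × s ≤ t ×
      (Σ ℕ λ k → IsChromaticNumber (deleteEdge G e) k × k ≤ s)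
mainTheorem14 n m t G f e _ _ _ (f-bij , f-adjacent) c[f]≡t same-deg shifted-distinct f[e]≡0 =
  let (s , χla[H]≡s , s≤t) = least (dec-attains H) lower-attains-t
      (k , χ[H]≡k , k≤s) = least (dec-colourable H) (attains⇒colourable H (proj₁ χla[H]≡s))
  in s , χla[H]≡s , s≤t , k , χ[H]≡k , k≤s
  where
  open LowerLabels f f-bij e (toℕ-injective f[e]≡0)
  H : Graph n m
  H = deleteEdge G e

  lower⁺ : ∀ x → vsum H lower x ≡ vsum G f x ∸ deg G x
  lower⁺ x = sym (trans (cong (_∸ deg G x) (vsum-lower G x)) (m+n∸m≡n (deg G x) _))

  f⇒lower : ∀ x y → vsum G f x ≡ vsum G f y → vsum H lower x ≡ vsum H lower y
  f⇒lower x y eq = trans (lower⁺ x) (trans (cong₂ _∸_ eq (same-deg x y eq)) (sym (lower⁺ y)))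

  lower⇒f : ∀ x y → vsum H lower x ≡ vsum H lower y → vsum G f x ≡ vsum G f y
  lower⇒f x y eq with vsum G f x ≟ vsum G f y
  ... | yes f-eq = f-eq
  ... | no f-neq =
    contradiction (trans (sym (lower⁺ x)) (trans eq (lower⁺ y))) (shifted-distinct x y f-neq)

  lower-attains-t : LAAttains H t
  lower-attains-t = lower , (lower-bij , adjacent-distinct) ,
    trans (countDistinct-kernel (vsum H lower) (vsum G f) lower⇒f f⇒lower (allFin n)) c[f]≡t
    where
    adjacent-distinct : ∀ i → vsum H lower (proj₁ (H i)) ≢ vsum H lower (proj₂ (H i))
    adjacent-distinct i = f-adjacent (punchIn e i) ∘ lower⇒f (proj₁ (H i)) (proj₂ (H i))
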